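{- Let $G$ be a graph and let $U$ and $V$ be disjoint sets of vertices of $G$ such that each $u\in U$ is adjacent in $G$ to at most three vertices of $V$. If $|U|\geq 4$ and $|V|\geq 8$, then $\overline{G}[U\cup V]$ contains a cycle $C_8$.
   Context: Graphs are finite and simple; $\overline{G}$ is the complement of $G$ and $\overline{G}[X]$ is the subgraph of $\overline{G}$ induced by $X$. -}

module Defs where

open import Data.Nat using (ℕ; suc; _≤_)
open import Data.Bool using (Bool; true; false)
open import Data.Fin using (Fin; zero; suc)
open import Data.Fin.Subset using (Subset; _∈_; _∩_; _∪_; ∣_∣; Empty)
open import Data.Vec using (tabulate)
open import Data.Product using (Σ; _×_; ∃)
open import Relation.Binary.PropositionalEquality using (_≡_)
open import Relation.Nullary using (¬_)
open import Function.Definitions using (Injective)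

record Graph (n : ℕ) : Set where
  field
    adj   : Fin n → Fin n → Bool
    sym   : ∀ u v → adj u v ≡ adj v u
    irrefl : ∀ v → adj v v ≡ false

open Graph public

N : ∀ {n} → Graph n → Fin n → Subset n
N G u = tabulate (adj G u)

Disjoint : ∀ {n} → Subset n → Subset n → Set
Disjoint U V = Empty (U ∩ V)

next8 : Fin 8 → Fin 8
next8 zero = suc zero
next8 (suc zero) = suc (suc zero)
next8 (suc (suc zero)) = suc (suc (suc zero))
next8 (suc (suc (suc zero))) = suc (suc (suc (suc zero)))
next8 (suc (suc (suc (suc zero)))) = suc (suc (suc (suc (suc zero))))
next8 (suc (suc (suc (suc (suc zero))))) = suc (suc (suc (suc (suc (suc zero)))))
next8 (suc (suc (suc (suc (suc (suc zero)))))) = suc (suc (suc (suc (suc (suc (suc zero))))))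
next8 (suc (suc (suc (suc (suc (suc (suc zero))))))) = zero

-- The complement of G induced on X contains a cycle C₈ (as a subgraph, not
-- necessarily induced): eight distinct vertices of X, consecutive ones
-- (cyclically) non-adjacent in G, i.e. adjacent in the complement.
ComplementHasC8 : ∀ {n} → Graph n → Subset n → Set
ComplementHasC8 {n} G X =
  Σ (Fin 8 → Fin n) λ f →
    Injective _≡_ _≡_ f
    × (∀ i → f i ∈ X)
    × (∀ i → adj G (f i) (f (next8 i)) ≡ false)

-- Fix four vertices u₀, …, u₃ of U and call the type of a vertex x of V the set of the uᵢ adjacent
-- to x. A C₈ of the complement is obtained from one of the three cyclic orders of the uᵢ together
-- with distinct vertices x₀, …, x₃ of V, each xₖ non-adjacent to the k-th and the (k+1)-th vertex
-- of that order. Whether such a choice exists depends only on the census of V, the number of its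
-- vertices of each of the 16 types; by hypothesis the census has total at least 8 and each uᵢ lies
-- in the types of at most 3 vertices. Lowering the census to total exactly 8 leaves finitely many
-- cases, which an exhaustive backtracking search settles. A successful search is turned back into
-- distinct vertices greedily, type by type.

module Submission where

open import Defs hiding (sym)
open import Data.Bool.Base using (Bool; true; false; _∧_; not; T; if_then_else_)
open import Data.Bool.Properties using (T?; T-∧; T-≡; T-not-≡; ∧-identityʳ; ∧-comm)
open import Data.Nat.Base using (ℕ; zero; suc; _+_; _*_; _∸_; _^_; _⊓_; _≤_; _<_; z≤n; s≤s; pred)
open import Data.Nat.Properties
  using (+-*-semiring; _≤?_; ≤-refl; ≤-reflexive; ≤-trans; <⇒≤; ≰⇒>; m<1+n⇒m≤n; ≤∧≢⇒<; n<1+n;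
         +-comm; +-identityʳ; +-mono-≤; +-cancelˡ-<; m≤m+n; m≤n+m; m+n≤o⇒m≤o; m+n≤o⇒m≤o∸n;
         m+n∸m≡n; m+n∸n≡m; m∸n+n≡m; ∸-monoˡ-≤; *-identityˡ; *-comm; *-assoc; *-monoʳ-≤; ⊓-glb;
         module ≤-Reasoning)
  renaming (_≟_ to _≟ℕ_)
open import Data.Fin.Base using (Fin; zero; suc; _↑ˡ_; _↑ʳ_; remQuot; combine)
open import Data.Fin.Properties using (_≟_; combine-remQuot)
open import Data.Fin.Patterns using (0F; 1F; 2F; 3F; 4F; 5F; 6F; 7F)
open import Data.Fin.Permutation as Perm using (Permutation; _⟨$⟩ʳ_; _⟨$⟩ˡ_; transpose; inverseˡ)
open import Data.Fin.Subset using (Subset; inside; outside; _∈_; _∩_; _∪_; ∣_∣)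
open import Data.Fin.Subset.Properties using (x∈p∩q⁺; x∈p∪q⁺)
open import Data.Vec.Base using (Vec; []; _∷_; lookup; tabulate; map; _++_; zipWith; foldr′; _[_]%=_; allFin; replicate)
open import Data.Vec.Properties
  using (lookup-++ˡ; lookup-++ʳ; lookup-map; lookup-replicate; lookup∘tabulate; lookup-zipWith; lookup⇒[]=;
         lookup∘updateAt; lookup∘updateAt′)
open import Data.Vec.Functional using () renaming (_∷_ to _◂_)
open import Data.List.Base as List using (List; mapMaybe; head)
open import Data.Maybe.Base as Maybe using (Maybe; just; nothing; is-just)
open import Data.Product.Base using (Σ-syntax; _×_; _,_; proj₁; proj₂; uncurry)
open import Data.Sum.Base using (inj₁; inj₂)
open import Data.Empty using (⊥-elim)
open import Data.Unit.Base using (tt)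
open import Function.Base using (_∘_; id)
open import Function.Bundles using (Equivalence)
open import Function.Definitions using (Injective)
open import Relation.Binary.PropositionalEquality
  using (_≡_; _≢_; refl; sym; trans; cong; cong₂; subst; subst₂; module ≡-Reasoning)
open import Relation.Nullary.Decidable using (does; yes; no; dec-true)
open import Algebra.Properties.Semiring.Sum +-*-semiring
  using (sum-syntax; sum-cong-≗; sum-replicate-zero; ∑-distrib-+; ∑-comm; *-distribˡ-sum)

open Equivalence using (to; from)

-- Counting

⟦_⟧ : Bool → ℕ
⟦ true ⟧  = 1
⟦ false ⟧ = 0

count : ∀ {n} → (Fin n → Bool) → ℕ
count {n} P = ∑[ x < n ] ⟦ P x ⟧

_==_ : ∀ {n} → Fin n → Fin n → Bool
i == j = does (i ≟ j)

==⇒≡ : ∀ {n} {i j : Fin n} → T (i == j) → i ≡ j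
==⇒≡ {i = i} {j} _ with i ≟ j
... | yes i≡j = i≡j

≡⇒== : ∀ {n} {i j : Fin n} → i ≡ j → T (i == j)
≡⇒== {i = i} {j} i≡j = from T-≡ (dec-true (i ≟ j) i≡j)

⟦⟧-mono : ∀ {a b} → (T a → T b) → ⟦ a ⟧ ≤ ⟦ b ⟧
⟦⟧-mono {false}        _   = z≤n
⟦⟧-mono {true} {true}  _   = ≤-refl
⟦⟧-mono {true} {false} a⇒b = ⊥-elim (a⇒b tt)

∑-mono-≤ : ∀ {n} {f g : Fin n → ℕ} → (∀ i → f i ≤ g i) → ∑[ i < n ] f i ≤ ∑[ i < n ] g i
∑-mono-≤ {zero}  _   = z≤n
∑-mono-≤ {suc n} f≤g = +-mono-≤ (f≤g zero) (∑-mono-≤ (f≤g ∘ suc))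

∑-δ : ∀ {n} (a : Fin n) (g : Fin n → ℕ) → ∑[ j < n ] (⟦ a == j ⟧ * g j) ≡ g a
∑-δ {suc n} zero    g = trans (cong₂ _+_ (*-identityˡ (g zero)) (sum-replicate-zero n)) (+-identityʳ (g zero))
∑-δ {suc n} (suc a) g = ∑-δ a (g ∘ suc)

card≡count : ∀ {n} (S : Subset n) → ∣ S ∣ ≡ count (lookup S)
card≡count []            = refl
card≡count (inside ∷ S)  = cong suc (card≡count S)
card≡count (outside ∷ S) = card≡count S

count-mono : ∀ {n} {P Q : Fin n → Bool} → (∀ x → T (P x) → T (Q x)) → count P ≤ count Q
count-mono P⇒Q = ∑-mono-≤ (λ x → ⟦⟧-mono (P⇒Q x))

count-const : ∀ {k} → count {k} (λ _ → true) ≡ k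
count-const {zero}  = refl
count-const {suc k} = cong suc (count-const {k})

count-witness : ∀ {n} (P : Fin n → Bool) → 0 < count P → Σ[ x ∈ Fin n ] T (P x)
count-witness {suc n} P pos with P zero in P₀
... | true  = zero , from T-≡ P₀
... | false = let x , Px = count-witness (P ∘ suc) pos in suc x , Px

count-remove : ∀ {n} (P : Fin n → Bool) (y : Fin n) → count P ≡ ⟦ P y ⟧ + count (λ x → P x ∧ not (y == x))
count-remove {n} P y = begin
  count P                                                       ≡⟨ sum-cong-≗ (λ x → split (y == x) (P x)) ⟩
  ∑[ x < n ] (⟦ y == x ⟧ * ⟦ P x ⟧ + ⟦ P x ∧ not (y == x) ⟧)     ≡⟨ ∑-distrib-+ (λ x → ⟦ y == x ⟧ * ⟦ P x ⟧) _ ⟩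
  ∑[ x < n ] (⟦ y == x ⟧ * ⟦ P x ⟧) + count P∖y                  ≡⟨ cong (_+ count P∖y) (∑-δ y (λ x → ⟦ P x ⟧)) ⟩
  ⟦ P y ⟧ + count P∖y                                           ∎
  where
  open ≡-Reasoning
  P∖y : Fin n → Bool
  P∖y x = P x ∧ not (y == x)
  split : ∀ a b → ⟦ b ⟧ ≡ ⟦ a ⟧ * ⟦ b ⟧ + ⟦ b ∧ not a ⟧
  split true  true  = refl
  split true  false = refl
  split false true  = refl
  split false false = refl

fresh : ∀ {n k} (P : Fin n → Bool) (xs : Fin k → Fin n) → count (P ∘ xs) < count P
      → Σ[ y ∈ Fin n ] T (P y) × (∀ i → xs i ≢ y)
fresh {k = zero}  P xs lt = let y , Py = count-witness P lt in y , Py , λ ()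
fresh {n} {suc k} P xs lt = y , proj₁ (to T-∧ P′y) , missed
  where
  x₀ : Fin n
  x₀ = xs zero
  P′ : Fin n → Bool
  P′ x = P x ∧ not (x₀ == x)
  lt′ : count (P′ ∘ xs ∘ suc) < count P′
  lt′ = begin-strict
    count (P′ ∘ xs ∘ suc) ≤⟨ count-mono {P = P′ ∘ xs ∘ suc} {Q = P ∘ xs ∘ suc} (λ _ → proj₁ ∘ to T-∧) ⟩
    count (P ∘ xs ∘ suc)  <⟨ +-cancelˡ-< ⟦ P x₀ ⟧ _ _ (subst (count (P ∘ xs) <_) (count-remove P x₀) lt) ⟩
    count P′              ∎
    where open ≤-Reasoning
  rest : Σ[ y ∈ Fin n ] T (P′ y) × (∀ i → xs (suc i) ≢ y)
  rest = fresh P′ (xs ∘ suc) lt′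
  y : Fin n
  y = proj₁ rest
  P′y : T (P′ y)
  P′y = proj₁ (proj₂ rest)
  missed : ∀ i → xs i ≢ y
  missed zero    x₀≡y = subst T (to T-not-≡ (proj₂ (to (T-∧ {P y}) P′y))) (≡⇒== x₀≡y)
  missed (suc i)      = proj₂ (proj₂ rest) i

-- Distinct representatives and selections of types

mult : ∀ {k m} → (Fin k → Fin m) → Fin m → ℕ
mult ts t = count (λ i → ts i == t)

module _ {n m} (S : Fin n → Bool) (τ : Fin n → Fin m) where

  census : Fin m → ℕ
  census t = count (λ x → S x ∧ τ x == t)

  record Realization {k} (ts : Fin k → Fin m) : Set where
    field
      elements  : Fin k → Fin n
      injective : Injective _≡_ _≡_ elements
      chosen-in : ∀ i → T (S (elements i))
      typed     : ∀ i → τ (elements i) ≡ ts i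

  -- Elements are chosen one at a time: a new one only has to avoid the earlier ones of its own type.
  realize : ∀ {k} (ts : Fin k → Fin m) → (∀ t → mult ts t ≤ census t) → Realization ts
  realize {zero}  ts _    = record { elements = λ () ; injective = λ { {()} } ; chosen-in = λ () ; typed = λ () }
  realize {suc k} ts fits = record
    { elements  = y ◂ xs
    ; injective = injective′
    ; chosen-in = λ { zero → proj₁ Py ; (suc i) → xs-in-S i }
    ; typed     = λ { zero → ==⇒≡ (proj₂ Py) ; (suc i) → xs-typed i }
    }
    where
    t₀ : Fin m
    t₀ = ts zero
    rest : Realization (ts ∘ suc)
    rest = realize (ts ∘ suc) (λ t → ≤-trans (m≤n+m _ ⟦ t₀ == t ⟧) (fits t))
    open Realization rest renaming (elements to xs; injective to xs-injective; chosen-in to xs-in-S; typed to xs-typed)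
    P : Fin n → Bool
    P x = S x ∧ τ x == t₀
    fewer : count (P ∘ xs) < census t₀
    fewer = begin-strict
      count (P ∘ xs)                ≡⟨ sum-cong-≗ (λ i → cong₂ (λ a b → ⟦ a ∧ b == t₀ ⟧) (to T-≡ (xs-in-S i)) (xs-typed i)) ⟩
      mult (ts ∘ suc) t₀            <⟨ n<1+n _ ⟩
      ⟦ true ⟧ + mult (ts ∘ suc) t₀ ≡⟨ cong (λ b → ⟦ b ⟧ + mult (ts ∘ suc) t₀) (to T-≡ (≡⇒== {i = t₀} refl)) ⟨
      mult ts t₀                    ≤⟨ fits t₀ ⟩
      census t₀                     ∎
      where open ≤-Reasoning
    new : Σ[ y ∈ Fin n ] T (P y) × (∀ i → xs i ≢ y)
    new = fresh P xs fewer
    y : Fin n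
    y = proj₁ new
    Py : T (S y) × T (τ y == t₀)
    Py = to T-∧ (proj₁ (proj₂ new))
    injective′ : Injective _≡_ _≡_ (y ◂ xs)
    injective′ {zero}  {zero}  _  = refl
    injective′ {zero}  {suc j} eq = ⊥-elim (proj₂ (proj₂ new) j (sym eq))
    injective′ {suc i} {zero}  eq = ⊥-elim (proj₂ (proj₂ new) i eq)
    injective′ {suc i} {suc j} eq = cong suc (xs-injective eq)

injection-into : ∀ {n k} (S : Fin n → Bool) → k ≤ count S
               → Σ[ xs ∈ (Fin k → Fin n) ] Injective _≡_ _≡_ xs × (∀ i → T (S (xs i)))
injection-into {n} {k} S k≤S = elements , injective , chosen-in
  where
  fits : ∀ t → mult {k} {1} (λ _ → zero) t ≤ census S (λ _ → zero) t
  fits zero = subst₂ _≤_ (sym count-const) (sum-cong-≗ (λ x → cong ⟦_⟧ (sym (∧-identityʳ (S x))))) k≤S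
  open Realization (realize S (λ _ → zero) {k} (λ _ → zero) fits)

count-partition : ∀ {n m} (P : Fin n → Bool) (τ : Fin n → Fin m) (w : Fin m → Bool)
                → count (λ x → P x ∧ w (τ x)) ≡ ∑[ t < m ] (⟦ w t ⟧ * census P τ t)
count-partition {n} {m} P τ w = begin
  ∑[ x < n ] ⟦ P x ∧ w (τ x) ⟧                              ≡⟨ sum-cong-≗ spread ⟩
  ∑[ x < n ] ∑[ t < m ] (⟦ τ x == t ⟧ * (⟦ w t ⟧ * ⟦ P x ⟧)) ≡⟨ ∑-comm (λ x t → ⟦ τ x == t ⟧ * (⟦ w t ⟧ * ⟦ P x ⟧)) ⟩
  ∑[ t < m ] ∑[ x < n ] (⟦ τ x == t ⟧ * (⟦ w t ⟧ * ⟦ P x ⟧)) ≡⟨ sum-cong-≗ collect ⟩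
  ∑[ t < m ] (⟦ w t ⟧ * census P τ t)                       ∎
  where
  open ≡-Reasoning
  ⟦∧⟧ : ∀ a b → ⟦ a ∧ b ⟧ ≡ ⟦ a ⟧ * ⟦ b ⟧
  ⟦∧⟧ true  b = sym (*-identityˡ ⟦ b ⟧)
  ⟦∧⟧ false b = refl
  spread : ∀ x → ⟦ P x ∧ w (τ x) ⟧ ≡ ∑[ t < m ] (⟦ τ x == t ⟧ * (⟦ w t ⟧ * ⟦ P x ⟧))
  spread x = trans (⟦∧⟧ (P x) (w (τ x))) (trans (*-comm ⟦ P x ⟧ _) (sym (∑-δ (τ x) (λ t → ⟦ w t ⟧ * ⟦ P x ⟧))))
  regroup : ∀ a b c → ⟦ a ⟧ * (⟦ b ⟧ * ⟦ c ⟧) ≡ ⟦ b ⟧ * ⟦ c ∧ a ⟧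
  regroup a b c = begin
    ⟦ a ⟧ * (⟦ b ⟧ * ⟦ c ⟧) ≡⟨ *-assoc ⟦ a ⟧ _ _ ⟨
    ⟦ a ⟧ * ⟦ b ⟧ * ⟦ c ⟧   ≡⟨ cong (_* ⟦ c ⟧) (*-comm ⟦ a ⟧ _) ⟩
    ⟦ b ⟧ * ⟦ a ⟧ * ⟦ c ⟧   ≡⟨ *-assoc ⟦ b ⟧ _ _ ⟩
    ⟦ b ⟧ * (⟦ a ⟧ * ⟦ c ⟧) ≡⟨ cong (⟦ b ⟧ *_) (trans (*-comm ⟦ a ⟧ _) (sym (⟦∧⟧ c a))) ⟩
    ⟦ b ⟧ * ⟦ c ∧ a ⟧       ∎
  collect : ∀ t → ∑[ x < n ] (⟦ τ x == t ⟧ * (⟦ w t ⟧ * ⟦ P x ⟧)) ≡ ⟦ w t ⟧ * census P τ t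
  collect t = trans (sum-cong-≗ (λ x → regroup (τ x == t) (w t) (P x))) (sym (*-distribˡ-sum ⟦ w t ⟧ (λ x → ⟦ P x ∧ τ x == t ⟧)))

record Selection {k m} (admits : Fin k → Fin m → Bool) (c : Fin m → ℕ) : Set where
  field
    pick     : Fin k → Fin m
    admitted : ∀ i → T (admits i (pick i))
    within   : ∀ t → mult pick t ≤ c t

selection-mono : ∀ {k m} {admits : Fin k → Fin m → Bool} {c d : Fin m → ℕ}
               → (∀ t → c t ≤ d t) → Selection admits c → Selection admits d
selection-mono c≤d s = record { pick = pick ; admitted = admitted ; within = λ t → ≤-trans (within t) (c≤d t) }
  where open Selection s

selection-cons : ∀ {k m} {admits : Fin (suc k) → Fin m → Bool} {cs : Vec ℕ m} {t : Fin m}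
               → T (admits zero t) → 0 < lookup cs t → Selection (admits ∘ suc) (lookup (cs [ t ]%= pred))
               → Selection admits (lookup cs)
selection-cons {cs = cs} {t} admitted-t positive s = record
  { pick     = t ◂ pick
  ; admitted = λ { zero → admitted-t ; (suc i) → admitted i }
  ; within   = within′
  }
  where
  open Selection s
  ≤pred⇒< : ∀ {a b} → 0 < b → a ≤ pred b → a < b
  ≤pred⇒< {b = suc b} _ a≤b = s≤s a≤b
  within′ : ∀ t′ → mult (t ◂ pick) t′ ≤ lookup cs t′
  within′ t′ with t ≟ t′
  ... | yes refl = ≤pred⇒< positive (≤-trans (within t) (≤-reflexive (lookup∘updateAt t cs)))
  ... | no  t≢t′ = ≤-trans (within t′) (≤-reflexive (lookup∘updateAt′ t′ t (t≢t′ ∘ sym) cs))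

select? : ∀ {m} → List (Fin m) → ∀ k (admits : Fin k → Fin m → Bool) (cs : Vec ℕ m)
        → Maybe (Selection admits (lookup cs))
select? candidates zero    admits cs = just record { pick = λ () ; admitted = λ () ; within = λ _ → z≤n }
select? {m} candidates (suc k) admits cs = head (mapMaybe try candidates)
  where
  try : Fin m → Maybe (Selection admits (lookup cs))
  try t with T? (admits zero t) | 1 ≤? lookup cs t
  ... | yes admitted-t | yes positive =
          Maybe.map (selection-cons {cs = cs} admitted-t positive) (select? candidates k (admits ∘ suc) (cs [ t ]%= pred))
  ... | _ | _ = nothing

-- Adjacency types and cycle certificates

subsets : ∀ k → Vec (Subset k) (2 ^ k)
subsets zero    = [] ∷ []
subsets (suc k) = map (inside ∷_) (subsets k) ++ map (outside ∷_) (subsets k) ++ []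

encode : ∀ {k} → Subset k → Fin (2 ^ k)
encode []                    = zero
encode {suc k} (inside ∷ s)  = encode s ↑ˡ (2 ^ k + 0)
encode {suc k} (outside ∷ s) = 2 ^ k ↑ʳ (encode s ↑ˡ 0)

lookup-subsets : ∀ {k} (s : Subset k) → lookup (subsets k) (encode s) ≡ s
lookup-subsets [] = refl
lookup-subsets {suc k} (inside ∷ s) = begin
  lookup (insides ++ _) (encode s ↑ˡ _)  ≡⟨ lookup-++ˡ insides _ (encode s) ⟩
  lookup insides (encode s)              ≡⟨ lookup-map (encode s) (inside ∷_) (subsets k) ⟩
  inside ∷ lookup (subsets k) (encode s) ≡⟨ cong (inside ∷_) (lookup-subsets s) ⟩
  inside ∷ s                             ∎
  where
  open ≡-Reasoning
  insides : Vec (Subset (suc k)) (2 ^ k)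
  insides = map (inside ∷_) (subsets k)
lookup-subsets {suc k} (outside ∷ s) = begin
  lookup (insides ++ outsides ++ []) (2 ^ k ↑ʳ (encode s ↑ˡ 0)) ≡⟨ lookup-++ʳ insides (outsides ++ []) _ ⟩
  lookup (outsides ++ []) (encode s ↑ˡ 0)                      ≡⟨ lookup-++ˡ outsides [] (encode s) ⟩
  lookup outsides (encode s)                                   ≡⟨ lookup-map (encode s) (outside ∷_) (subsets k) ⟩
  outside ∷ lookup (subsets k) (encode s)                      ≡⟨ cong (outside ∷_) (lookup-subsets s) ⟩
  outside ∷ s                                                  ∎
  where
  open ≡-Reasoning
  insides outsides : Vec (Subset (suc k)) (2 ^ k)
  insides = map (inside ∷_) (subsets k)
  outsides = map (outside ∷_) (subsets k)

-- A literal copy of subsets 4: the exhaustive check below reads it at every step, and evaluating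
-- subsets 4 there instead makes the check several times slower. It runs from the full set down to
-- the empty set, the order in which the check enumerates the types.
types : Vec (Subset 4) 16
types =
  (inside  ∷ inside  ∷ inside  ∷ inside  ∷ []) ∷
  (inside  ∷ inside  ∷ inside  ∷ outside ∷ []) ∷
  (inside  ∷ inside  ∷ outside ∷ inside  ∷ []) ∷
  (inside  ∷ inside  ∷ outside ∷ outside ∷ []) ∷
  (inside  ∷ outside ∷ inside  ∷ inside  ∷ []) ∷
  (inside  ∷ outside ∷ inside  ∷ outside ∷ []) ∷
  (inside  ∷ outside ∷ outside ∷ inside  ∷ []) ∷
  (inside  ∷ outside ∷ outside ∷ outside ∷ []) ∷
  (outside ∷ inside  ∷ inside  ∷ inside  ∷ []) ∷
  (outside ∷ inside  ∷ inside  ∷ outside ∷ []) ∷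
  (outside ∷ inside  ∷ outside ∷ inside  ∷ []) ∷
  (outside ∷ inside  ∷ outside ∷ outside ∷ []) ∷
  (outside ∷ outside ∷ inside  ∷ inside  ∷ []) ∷
  (outside ∷ outside ∷ inside  ∷ outside ∷ []) ∷
  (outside ∷ outside ∷ outside ∷ inside  ∷ []) ∷
  (outside ∷ outside ∷ outside ∷ outside ∷ []) ∷ []

types≡subsets : types ≡ subsets 4
types≡subsets = refl

lookup-types : (s : Subset 4) → lookup types (encode s) ≡ s
lookup-types s = trans (cong (λ ts → lookup ts (encode s)) types≡subsets) (lookup-subsets s)

member : Fin 16 → Fin 4 → Bool
member t i = lookup (lookup types t) i

load : (Fin 16 → ℕ) → Fin 4 → ℕ
load c i = ∑[ t < 16 ] (⟦ member t i ⟧ * c t)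

next4 : Fin 4 → Fin 4
next4 0F = 1F
next4 1F = 2F
next4 2F = 3F
next4 3F = 0F

-- The three Hamiltonian cycles of K₄, as relabellings of the cycle 0, 1, 2, 3.
cyclicOrder : Fin 3 → Permutation 4 4
cyclicOrder 0F = Perm.id
cyclicOrder 1F = transpose 1F 2F
cyclicOrder 2F = transpose 2F 3F

between : Fin 3 → Fin 4 → Fin 16 → Bool
between o k t = not (member t (cyclicOrder o ⟨$⟩ʳ k)) ∧ not (member t (cyclicOrder o ⟨$⟩ʳ next4 k))

CycleCertificate : (Fin 16 → ℕ) → Set
CycleCertificate c = Σ[ o ∈ Fin 3 ] Selection (between o) c

-- Trying the empty type first keeps the backtracking short.
certificate? : (cs : Vec ℕ 16) → Maybe (CycleCertificate (lookup cs))
certificate? cs =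
  head (mapMaybe (λ o → Maybe.map (o ,_) (select? (List.reverse (List.allFin 16)) 4 (between o) cs)) (List.allFin 3))

certifiable : Vec ℕ 16 → Bool
certifiable cs = is-just (certificate? cs)

from-is-just : ∀ {A : Set} (m : Maybe A) → T (is-just m) → A
from-is-just (just a) _ = a

-- The exhaustive check

Budget : Set
Budget = Vec ℕ 4

spend : Fin 16 → ℕ → Budget → Budget
spend t k b = zipWith (λ x bᵢ → bᵢ ∸ ⟦ x ⟧ * k) (lookup types t) b

capacity : Fin 16 → Budget → ℕ → ℕ
capacity t b r = foldr′ _⊓_ r (zipWith (λ x bᵢ → if x then bᵢ else r) (lookup types t) b)

allUpTo : ℕ → (ℕ → Bool) → Bool
allUpTo zero    p = p zero
allUpTo (suc k) p = p (suc k) ∧ allUpTo k p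

everyCensus : ∀ {l} → Vec (Fin 16) l → Budget → ℕ → (Vec ℕ l → Bool) → Bool
everyCensus []       b zero    κ = κ []
everyCensus []       b (suc r) κ = true
everyCensus (t ∷ ts) b r       κ = allUpTo (capacity t b r) λ k → everyCensus ts (spend t k b) (r ∸ k) (κ ∘ (k ∷_))

allUpTo-sound : ∀ {k p m} → T (allUpTo k p) → m ≤ k → T (p m)
allUpTo-sound {zero}          all z≤n   = all
allUpTo-sound {suc k} {p} {m} all m≤1+k with m ≟ℕ suc k
... | yes refl  = proj₁ (to T-∧ all)
... | no  m≢1+k = allUpTo-sound (proj₂ (to (T-∧ {p (suc k)}) all)) (m<1+n⇒m≤n (≤∧≢⇒< m≤1+k m≢1+k))

≤-capacity : ∀ {l} (xs : Vec Bool l) (b : Vec ℕ l) {k r} → k ≤ r → (∀ i → ⟦ lookup xs i ⟧ * k ≤ lookup b i)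
           → k ≤ foldr′ _⊓_ r (zipWith (λ x bᵢ → if x then bᵢ else r) xs b)
≤-capacity []             []       k≤r _       = k≤r
≤-capacity (inside ∷ xs)  (bᵢ ∷ b) k≤r affords =
  ⊓-glb (subst (_≤ bᵢ) (*-identityˡ _) (affords zero)) (≤-capacity xs b k≤r (affords ∘ suc))
≤-capacity (outside ∷ xs) (bᵢ ∷ b) k≤r affords = ⊓-glb k≤r (≤-capacity xs b k≤r (affords ∘ suc))

loadᵛ : ∀ {l} → Vec (Fin 16) l → Vec ℕ l → Fin 4 → ℕ
loadᵛ {l} ts ks i = ∑[ p < l ] (⟦ member (lookup ts p) i ⟧ * lookup ks p)

everyCensus-complete : ∀ {l} (ts : Vec (Fin 16) l) b r κ → everyCensus ts b r κ ≡ true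
                     → ∀ ks → (∀ i → loadᵛ ts ks i ≤ lookup b i) → ∑[ p < l ] lookup ks p ≡ r → T (κ ks)
everyCensus-complete []       b zero κ all []       _     _     = from T-≡ all
everyCensus-complete (t ∷ ts) b r    κ all (k ∷ ks) loads total =
  everyCensus-complete ts (spend t k b) (r ∸ k) (κ ∘ (k ∷_)) (to T-≡ (allUpTo-sound (from T-≡ all) k≤capacity))
    ks loads′ total′
  where
  k≤capacity : k ≤ capacity t b r
  k≤capacity = ≤-capacity (lookup types t) b (subst (k ≤_) total (m≤m+n k _)) (λ i → m+n≤o⇒m≤o _ (loads i))
  loads′ : ∀ i → loadᵛ ts ks i ≤ lookup (spend t k b) i
  loads′ i = subst (loadᵛ ts ks i ≤_) (sym (lookup-zipWith _ i (lookup types t) b))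
               (m+n≤o⇒m≤o∸n (loadᵛ ts ks i) (subst (_≤ lookup b i) (+-comm _ (loadᵛ ts ks i)) (loads i)))
  total′ : ∑[ p < _ ] lookup ks p ≡ r ∸ k
  total′ = trans (sym (m+n∸m≡n k _)) (cong (_∸ k) total)

-- Stated with ≡ true rather than T: Agda unfolds T before comparing types, so every use of a
-- T-statement would run the whole computation again.
every-census-certifiable : everyCensus (allFin 16) (replicate 4 3) 8 certifiable ≡ true
every-census-certifiable = refl

∑-shrink : ∀ {n} (f : Fin n → ℕ) {r} → r ≤ ∑[ i < n ] f i
         → Σ[ g ∈ (Fin n → ℕ) ] (∀ i → g i ≤ f i) × ∑[ i < n ] g i ≡ r
∑-shrink {zero}  f z≤n = f , (λ ()) , refl
∑-shrink {suc n} f {r} r≤∑f with r ≤? ∑[ i < n ] f (suc i)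
... | yes r≤rest = let g , g≤f , ∑g = ∑-shrink (f ∘ suc) r≤rest in 0 ◂ g , (λ { zero → z≤n ; (suc i) → g≤f i }) , ∑g
... | no  r≰rest = r ∸ rest ◂ f ∘ suc , (λ { zero → head≤ ; (suc i) → ≤-refl }) , m∸n+n≡m (<⇒≤ (≰⇒> r≰rest))
  where
  rest : ℕ
  rest = ∑[ i < n ] f (suc i)
  head≤ : r ∸ rest ≤ f zero
  head≤ = subst (r ∸ rest ≤_) (m+n∸n≡m (f zero) rest) (∸-monoˡ-≤ rest r≤∑f)

cycle-certificate : (c : Fin 16 → ℕ) → (∀ i → load c i ≤ 3) → 8 ≤ ∑[ t < 16 ] c t → CycleCertificate c
cycle-certificate c loads total with ∑-shrink c total
... | g , g≤c , ∑g≡8 = proj₁ certificate , selection-mono ks≤c (proj₂ certificate)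
  where
  ks : Vec ℕ 16
  ks = tabulate g
  ks≤c : ∀ t → lookup ks t ≤ c t
  ks≤c t = subst (_≤ c t) (sym (lookup∘tabulate g t)) (g≤c t)
  loads′ : ∀ i → loadᵛ (allFin 16) ks i ≤ lookup (replicate 4 3) i
  loads′ i = begin
    loadᵛ (allFin 16) ks i   ≡⟨ sum-cong-≗ (λ t → cong₂ (λ t′ k → ⟦ member t′ i ⟧ * k) (lookup∘tabulate id t) (lookup∘tabulate g t)) ⟩
    load g i                 ≤⟨ ∑-mono-≤ (λ t → *-monoʳ-≤ ⟦ member t i ⟧ (g≤c t)) ⟩
    load c i                 ≤⟨ loads i ⟩
    3                        ≡⟨ lookup-replicate i 3 ⟨
    lookup (replicate 4 3) i ∎
    where open ≤-Reasoning
  certified : T (certifiable ks)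
  certified = everyCensus-complete (allFin 16) (replicate 4 3) 8 certifiable every-census-certifiable ks loads′
                (trans (sum-cong-≗ (lookup∘tabulate g)) ∑g≡8)
  certificate : CycleCertificate (lookup ks)
  certificate = from-is-just (certificate? ks) certified

-- Eight-cycles from alternating walks

interleave : ∀ {A : Set} → (Fin 4 → A) → (Fin 4 → A) → Fin 4 → Fin 2 → A
interleave g h k 0F = g k
interleave g h k 1F = h k

alternate : ∀ {A : Set} → (Fin 4 → A) → (Fin 4 → A) → Fin 8 → A
alternate g h = uncurry (interleave g h) ∘ remQuot 2

alternate-injective : ∀ {A : Set} {g h : Fin 4 → A} → Injective _≡_ _≡_ g → Injective _≡_ _≡_ h
                    → (∀ k l → g k ≢ h l) → Injective _≡_ _≡_ (alternate g h)
alternate-injective {g = g} {h} g-injective h-injective g≢h {i} {j} eq = begin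
  i                                 ≡⟨ combine-remQuot {4} 2 i ⟨
  uncurry combine (remQuot {4} 2 i) ≡⟨ cong (uncurry combine) (interleave-injective (remQuot 2 i) (remQuot 2 j) eq) ⟩
  uncurry combine (remQuot {4} 2 j) ≡⟨ combine-remQuot {4} 2 j ⟩
  j                                 ∎
  where
  open ≡-Reasoning
  interleave-injective : ∀ p q → uncurry (interleave g h) p ≡ uncurry (interleave g h) q → p ≡ q
  interleave-injective (k , 0F) (l , 0F) eq = cong (_, 0F) (g-injective eq)
  interleave-injective (k , 0F) (l , 1F) eq = ⊥-elim (g≢h k l eq)
  interleave-injective (k , 1F) (l , 0F) eq = ⊥-elim (g≢h l k (sym eq))
  interleave-injective (k , 1F) (l , 1F) eq = cong (_, 1F) (h-injective eq)

alternate-all : ∀ {A : Set} (P : A → Set) {g h : Fin 4 → A}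
              → (∀ k → P (g k)) → (∀ k → P (h k)) → ∀ i → P (alternate g h i)
alternate-all P {g} {h} Pg Ph i = interleave-all (remQuot 2 i)
  where
  interleave-all : ∀ p → P (uncurry (interleave g h) p)
  interleave-all (k , 0F) = Pg k
  interleave-all (k , 1F) = Ph k

alternate-steps : ∀ {A : Set} (R : A → A → Set) {g h : Fin 4 → A}
                → (∀ k → R (g k) (h k)) → (∀ k → R (h k) (g (next4 k)))
                → ∀ i → R (alternate g h i) (alternate g h (next8 i))
alternate-steps R gh hg 0F = gh 0F
alternate-steps R gh hg 1F = hg 0F
alternate-steps R gh hg 2F = gh 1F
alternate-steps R gh hg 3F = hg 1F
alternate-steps R gh hg 4F = gh 2F
alternate-steps R gh hg 5F = hg 2F
alternate-steps R gh hg 6F = gh 3F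
alternate-steps R gh hg 7F = hg 3F

C8-from-alternating-walk : ∀ {n} (G : Graph n) (X : Subset n) (g h : Fin 4 → Fin n)
                         → Injective _≡_ _≡_ g → Injective _≡_ _≡_ h → (∀ k l → g k ≢ h l)
                         → (∀ k → g k ∈ X) → (∀ k → h k ∈ X)
                         → (∀ k → adj G (g k) (h k) ≡ false) → (∀ k → adj G (h k) (g (next4 k)) ≡ false)
                         → ComplementHasC8 G X
C8-from-alternating-walk G X g h g-injective h-injective g≢h g∈X h∈X gh hg =
  alternate g h , alternate-injective g-injective h-injective g≢h ,
  alternate-all (_∈ X) g∈X h∈X , alternate-steps (λ x y → adj G x y ≡ false) gh hg

module _ {n} (G : Graph n) {U V : Subset n} (disjoint : Disjoint U V)
         (sparse : ∀ u → u ∈ U → ∣ N G u ∩ V ∣ ≤ 3)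
         (u : Fin 4 → Fin n) (u-injective : Injective _≡_ _≡_ u) (u∈U : ∀ i → u i ∈ U) where

  type : Fin n → Fin 16
  type x = encode (tabulate (λ i → adj G (u i) x))

  member-type : ∀ x i → member (type x) i ≡ adj G (u i) x
  member-type x i = begin
    lookup (lookup types (type x)) i          ≡⟨ cong (λ s → lookup s i) (lookup-types (tabulate (λ i → adj G (u i) x))) ⟩
    lookup (tabulate (λ i → adj G (u i) x)) i ≡⟨ lookup∘tabulate (λ i → adj G (u i) x) i ⟩
    adj G (u i) x                             ∎
    where open ≡-Reasoning

  V-census : Fin 16 → ℕ
  V-census = census (lookup V) type

  in-neighbourhood : ∀ i x → (lookup V x ∧ member (type x) i) ≡ lookup (N G (u i) ∩ V) x
  in-neighbourhood i x = begin
    lookup V x ∧ member (type x) i    ≡⟨ ∧-comm (lookup V x) _ ⟩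
    member (type x) i ∧ lookup V x    ≡⟨ cong (_∧ lookup V x) (trans (member-type x i) (sym (lookup∘tabulate _ x))) ⟩
    lookup (N G (u i)) x ∧ lookup V x ≡⟨ lookup-zipWith _∧_ x (N G (u i)) V ⟨
    lookup (N G (u i) ∩ V) x          ∎
    where open ≡-Reasoning

  V-census-load : ∀ i → load V-census i ≤ 3
  V-census-load i = begin
    load V-census i                              ≡⟨ count-partition (lookup V) type (λ t → member t i) ⟨
    count (λ x → lookup V x ∧ member (type x) i) ≡⟨ sum-cong-≗ (λ x → cong ⟦_⟧ (in-neighbourhood i x)) ⟩
    count (lookup (N G (u i) ∩ V))               ≡⟨ card≡count (N G (u i) ∩ V) ⟨
    ∣ N G (u i) ∩ V ∣                            ≤⟨ sparse (u i) (u∈U i) ⟩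
    3                                            ∎
    where open ≤-Reasoning

  V-census-total : 8 ≤ ∣ V ∣ → 8 ≤ ∑[ t < 16 ] V-census t
  V-census-total |V|≥8 = begin
    8                               ≤⟨ |V|≥8 ⟩
    ∣ V ∣                           ≡⟨ card≡count V ⟩
    count (lookup V)                ≡⟨ sum-cong-≗ (λ x → cong ⟦_⟧ (∧-identityʳ (lookup V x))) ⟨
    count (λ x → lookup V x ∧ true) ≡⟨ count-partition (lookup V) type (λ _ → true) ⟩
    ∑[ t < 16 ] (1 * V-census t)    ≡⟨ sum-cong-≗ (λ t → *-identityˡ (V-census t)) ⟩
    ∑[ t < 16 ] V-census t          ∎
    where open ≤-Reasoning

  C8-from-certificate : CycleCertificate V-census → ComplementHasC8 G (U ∪ V)
  C8-from-certificate (o , selection) =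
    C8-from-alternating-walk G (U ∪ V) (u ∘ σ) x (λ eq → σ-injective (u-injective eq)) x-injective u≢x
      (λ k → x∈p∪q⁺ (inj₁ (u∈U (σ k)))) (λ k → x∈p∪q⁺ (inj₂ (x∈V k)))
      (λ k → non-adjacent k (σ k) (proj₁ (avoids k)))
      (λ k → trans (Graph.sym G (x k) _) (non-adjacent k (σ (next4 k)) (proj₂ (avoids k))))
    where
    open Selection selection
    σ : Fin 4 → Fin 4
    σ k = cyclicOrder o ⟨$⟩ʳ k
    σ-injective : Injective _≡_ _≡_ σ
    σ-injective eq =
      trans (sym (inverseˡ (cyclicOrder o))) (trans (cong (cyclicOrder o ⟨$⟩ˡ_) eq) (inverseˡ (cyclicOrder o)))
    realized : Realization (lookup V) type pick
    realized = realize (lookup V) type pick within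
    open Realization realized renaming (elements to x; injective to x-injective)
    x∈V : ∀ k → x k ∈ V
    x∈V k = lookup⇒[]= (x k) V (to T-≡ (chosen-in k))
    non-adjacent : ∀ k i → member (pick k) i ≡ false → adj G (u i) (x k) ≡ false
    non-adjacent k i m = trans (sym (member-type (x k) i)) (trans (cong (λ t → member t i) (typed k)) m)
    avoids : ∀ k → member (pick k) (σ k) ≡ false × member (pick k) (σ (next4 k)) ≡ false
    avoids k = let a , b = to T-∧ (admitted k) in to T-not-≡ a , to T-not-≡ b
    u≢x : ∀ k l → u (σ k) ≢ x l
    u≢x k l eq = disjoint (x l , x∈p∩q⁺ (subst (_∈ U) eq (u∈U (σ k)) , x∈V l))

  complement-has-C8 : 8 ≤ ∣ V ∣ → ComplementHasC8 G (U ∪ V)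
  complement-has-C8 |V|≥8 = C8-from-certificate (cycle-certificate V-census V-census-load (V-census-total |V|≥8))

corollary2 : ∀ {n} (G : Graph n) (U V : Subset n)
    → Disjoint U V
    → (∀ u → u ∈ U → ∣ N G u ∩ V ∣ ≤ 3)
    → 4 ≤ ∣ U ∣
    → 8 ≤ ∣ V ∣
    → ComplementHasC8 G (U ∪ V)
corollary2 G U V disjoint sparse |U|≥4 |V|≥8 =
  let u , u-injective , u∈U = injection-into (lookup U) (subst (4 ≤_) (card≡count U) |U|≥4)
  in  complement-has-C8 G disjoint sparse u u-injective (λ i → lookup⇒[]= (u i) U (to T-≡ (u∈U i))) |V|≥8
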